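{- For $k\geq 0$ let $\phi_k(y)=\sum_{n\geq k+1}op_{n,k}y^n$, where $op_{n,k}$ is the number of ordered preference sets of length $n$ with exactly $k$ flaws. Then $\phi_k(y)=y^{k+1}[C(y)]^{2(k+1)}$, where $C(y)=\frac{1-\sqrt{1-4y}}{2y}=\sum_{n\geq0}\frac{1}{n+1}\binom{2n}{n}y^n$.
   Context: Parking model: $n$ parking spaces numbered $1,\dots,n$ from left to right; a preference set of length $n$ is a sequence $(a_1,\dots,a_n)$ with $a_i\in[n]$. Cars arrive in order; car $i$ goes to space $a_i$, and if it is occupied, moves to the first unoccupied space to the right; if there is none, the car cannot park. The number of flaws is the number of cars that cannot park. A preference set is ordered if $a_1\leq\cdots\leq a_n$. Identities are of formal power series in $y$. -}

module Defs where

open import Data.Nat using (ℕ; zero; suc; _+_; _*_; _∸_; _≤_; _<?_; _≤?_; _/_)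
open import Data.Nat.ListAction using (sum)
open import Data.Nat.Combinatorics using (_C_)
open import Data.Bool using (Bool; true; false; if_then_else_; _∧_)
open import Data.List using (List; []; _∷_; map; concatMap; filterᵇ; length; upTo; replicate)
open import Data.Fin using (Fin; toℕ)
open import Data.Vec using (Vec; []; _∷_; toList)
open import Data.Vec as Vec using ()
open import Data.Product using (_×_; _,_)
open import Relation.Nullary.Decidable using (⌊_⌋)
open import Data.Nat using (_≟_)

-- Formal power series in y with natural-number coefficients:
-- a series is its coefficient sequence (coefficient of y^n at index n).
Series : Set
Series = ℕ → ℕ

_⊛_ : Series → Series → Series
(f ⊛ g) n = sum (map (λ i → f i * g (n ∸ i)) (upTo (suc n)))

_^ˢ_ : Series → ℕ → Series
f ^ˢ zero = λ n → if ⌊ n ≟ 0 ⌋ then 1 else 0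
f ^ˢ suc m = f ⊛ (f ^ˢ m)

yPow : ℕ → Series
yPow m n = if ⌊ n ≟ m ⌋ then 1 else 0

Cser : Series
Cser n = ((n + n) C n) / suc n

seqs : (n len : ℕ) → List (List ℕ)
seqs n zero = [] ∷ []
seqs n (suc len) = concatMap (λ a → map (a ∷_) (seqs n len)) (map suc (upTo n))

prefSets : ℕ → List (List ℕ)
prefSets n = seqs n n

isOrdered : List ℕ → Bool
isOrdered [] = true
isOrdered (a ∷ []) = true
isOrdered (a ∷ b ∷ rest) = if ⌊ a ≤? b ⌋ then isOrdered (b ∷ rest) else false

-- Parking lot state: list of occupancy flags for spaces 1..n (true = occupied).
-- parkAt i lot: a car prefers space (i+1) (i counted from 0 in the remaining lot);
-- it takes the first unoccupied space at or to the right of its preference.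
-- Returns the new lot and whether the car parked.
parkAt : ℕ → List Bool → List Bool × Bool
parkAt i [] = [] , false
parkAt zero (false ∷ rest) = true ∷ rest , true
parkAt zero (true ∷ rest) with parkAt zero rest
... | rest' , ok = true ∷ rest' , ok
parkAt (suc i) (b ∷ rest) with parkAt i rest
... | rest' , ok = b ∷ rest' , ok

runFlaws : List ℕ → List Bool → ℕ
runFlaws [] lot = 0
runFlaws (a ∷ as) lot with parkAt (a ∸ 1) lot
... | lot' , true = runFlaws as lot'
... | lot' , false = suc (runFlaws as lot')

flaws : (n : ℕ) → List ℕ → ℕ
flaws n as = runFlaws as (replicate n false)

op : ℕ → ℕ → ℕ
op n k = length (filterᵇ (λ s → isOrdered s ∧ ⌊ flaws n s ≟ k ⌋) (prefSets n))

phi : ℕ → Series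
phi k n = if ⌊ suc k ≤? n ⌋ then op n k else 0

module Submission where

-- A nondecreasing preference list never looks left of its previous preference,
-- so what matters of the lot is a block of c occupied spaces followed by e free
-- ones.  Splitting by the first preference gives a Pascal-type recursion for the
-- number of lists of length l with at least k flaws on such a block: it is
-- C(l+c+e-1, l) if e + k ≤ l (at most e cars park) and C(l+c+e-1, c+e+k) otherwise
-- (for k ≥ 1).
-- On the empty lot of size n = k+1+m this gives op(n,k) = C(2n-1,m) - C(2n-1,m-1),
-- which is the coefficient of y^m in C(y)^(2k+2) because C = 1 + y C^2 yields
-- C^(r+1) = C^r + y C^(r+2).

open import Defs
open import Data.Nat
open import Data.Nat.Properties
open import Data.Nat.ListAction using (sum)
open import Data.Nat.Combinatorics
  using (_C_; nCk≡nC[n∸k]; k>n⇒nCk≡0; nC1≡n; nCn≡1) renaming (nCk+nC[k+1]≡[n+1]C[k+1] to pascal)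
open import Data.Nat.DivMod using (m*n/n≡m)
open import Data.Nat.Tactic.RingSolver using (solve-∀)
open import Data.Nat.ListAction.Properties using (sum-++)
open import Data.Bool using (Bool; true; false; if_then_else_; _∧_)
open import Data.Bool.Properties using (∧-zeroʳ)
open import Data.Product using (_,_; proj₁; proj₂)
open import Data.List using (List; []; _∷_; map; upTo; _++_; [_]; concatMap; filterᵇ; length; replicate)
open import Data.List.Properties
  using (map-applyUpTo; map-++; upTo-∷ʳ; map-∘; length-++; ++-assoc; length-replicate)
open import Function using (_∘_)
open import Relation.Nullary using (Dec; yes; no; ¬_; contradiction)
open import Relation.Nullary.Decidable using (⌊_⌋; isYes≗does; dec-true; dec-false)
open import Relation.Binary.PropositionalEquality hiding ([_])
open import Algebra.Properties.CommutativeSemigroup +-commutativeSemigroup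
  using () renaming (interchange to +-interchange)
open ≡-Reasoning

-- Finite sums and formal power series

sumTo : (ℕ → ℕ) → ℕ → ℕ
sumTo f n = sum (map f (upTo n))

sumTo-suc : ∀ f n → sumTo f (suc n) ≡ f 0 + sumTo (f ∘ suc) n
sumTo-suc f n = cong (λ xs → f 0 + sum xs)
  (trans (map-applyUpTo suc f n) (sym (map-applyUpTo (λ x → x) (f ∘ suc) n)))

sumTo-snoc : ∀ f n → sumTo f (suc n) ≡ sumTo f n + f n
sumTo-snoc f n = begin
  sum (map f (upTo (suc n)))      ≡⟨ cong (sum ∘ map f) (upTo-∷ʳ n) ⟨
  sum (map f (upTo n ++ [ n ]))   ≡⟨ cong sum (map-++ f (upTo n) [ n ]) ⟩
  sum (map f (upTo n) ++ [ f n ]) ≡⟨ sum-++ (map f (upTo n)) [ f n ] ⟩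
  sumTo f n + (f n + 0)           ≡⟨ cong (sumTo f n +_) (+-identityʳ (f n)) ⟩
  sumTo f n + f n                 ∎

sumTo-cong : ∀ {f g} n → (∀ i → i < n → f i ≡ g i) → sumTo f n ≡ sumTo g n
sumTo-cong zero f≡g = refl
sumTo-cong {f} {g} (suc n) f≡g = begin
  sumTo f (suc n)       ≡⟨ sumTo-suc f n ⟩
  f 0 + sumTo (f ∘ suc) n ≡⟨ cong₂ _+_ (f≡g 0 z<s) (sumTo-cong n (λ i i<n → f≡g (suc i) (s<s i<n))) ⟩
  g 0 + sumTo (g ∘ suc) n ≡⟨ sumTo-suc g n ⟨
  sumTo g (suc n)       ∎

sumTo-zeros : ∀ {f} n → (∀ i → i < n → f i ≡ 0) → sumTo f n ≡ 0
sumTo-zeros zero    f≡0 = refl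
sumTo-zeros {f} (suc n) f≡0 = begin
  sumTo f (suc n)         ≡⟨ sumTo-suc f n ⟩
  f 0 + sumTo (f ∘ suc) n ≡⟨ cong₂ _+_ (f≡0 0 z<s) (sumTo-zeros n (λ i i<n → f≡0 (suc i) (s<s i<n))) ⟩
  0                       ∎

sumTo-+ : ∀ f g n → sumTo (λ i → f i + g i) n ≡ sumTo f n + sumTo g n
sumTo-+ f g zero    = refl
sumTo-+ f g (suc n) = begin
  sumTo (λ i → f i + g i) (suc n)                    ≡⟨ sumTo-suc _ n ⟩
  (f 0 + g 0) + sumTo (λ i → f (suc i) + g (suc i)) n ≡⟨ cong (f 0 + g 0 +_) (sumTo-+ (f ∘ suc) (g ∘ suc) n) ⟩
  (f 0 + g 0) + (sumTo (f ∘ suc) n + sumTo (g ∘ suc) n) ≡⟨ +-interchange (f 0) (g 0) _ _ ⟩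
  (f 0 + sumTo (f ∘ suc) n) + (g 0 + sumTo (g ∘ suc) n) ≡⟨ cong₂ _+_ (sumTo-suc f n) (sumTo-suc g n) ⟨
  sumTo f (suc n) + sumTo g (suc n)                  ∎

sumTo-split : ∀ f p m → sumTo f (p + m) ≡ sumTo f p + sumTo (λ t → f (p + t)) m
sumTo-split f zero    m = refl
sumTo-split f (suc p) m = begin
  sumTo f (suc (p + m))
    ≡⟨ sumTo-suc f (p + m) ⟩
  f 0 + sumTo (f ∘ suc) (p + m)
    ≡⟨ cong (f 0 +_) (sumTo-split (f ∘ suc) p m) ⟩
  f 0 + (sumTo (f ∘ suc) p + sumTo (λ t → f (suc p + t)) m)
    ≡⟨ +-assoc (f 0) _ _ ⟨
  (f 0 + sumTo (f ∘ suc) p) + sumTo (λ t → f (suc p + t)) m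
    ≡⟨ cong (_+ sumTo (λ t → f (suc p + t)) m) (sumTo-suc f p) ⟨
  sumTo f (suc p) + sumTo (λ t → f (suc p + t)) m ∎

𝟙 : Series
𝟙 n = if ⌊ n ≟ 0 ⌋ then 1 else 0

infixl 6 _⊕_
infix 8 y·_

_⊕_ : Series → Series → Series
(f ⊕ g) n = f n + g n

y·_ : Series → Series
(y· g) zero    = 0
(y· g) (suc n) = g n

⊛-congˡ : ∀ f {g g′} → g ≗ g′ → f ⊛ g ≗ f ⊛ g′
⊛-congˡ f g≗g′ n = sumTo-cong (suc n) (λ i _ → cong (f i *_) (g≗g′ (n ∸ i)))

⊛-identityʳ : ∀ f → f ⊛ 𝟙 ≗ f
⊛-identityʳ f n = begin
  sumTo (λ i → f i * 𝟙 (n ∸ i)) (suc n)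
    ≡⟨ sumTo-snoc (λ i → f i * 𝟙 (n ∸ i)) n ⟩
  sumTo (λ i → f i * 𝟙 (n ∸ i)) n + f n * 𝟙 (n ∸ n)
    ≡⟨ cong₂ _+_ (sumTo-zeros n off-diagonal) (cong (λ j → f n * 𝟙 j) (n∸n≡0 n)) ⟩
  f n * 1
    ≡⟨ *-identityʳ (f n) ⟩
  f n ∎
  where
  off-diagonal : ∀ i → i < n → f i * 𝟙 (n ∸ i) ≡ 0
  off-diagonal i i<n = trans (cong (λ j → f i * 𝟙 j) (+-∸-assoc 1 i<n)) (*-zeroʳ (f i))

⊛-distribˡ-⊕ : ∀ f g h → f ⊛ (g ⊕ h) ≗ (f ⊛ g) ⊕ (f ⊛ h)
⊛-distribˡ-⊕ f g h n =
  trans (sumTo-cong (suc n) (λ i _ → *-distribˡ-+ (f i) (g (n ∸ i)) (h (n ∸ i))))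
        (sumTo-+ (λ i → f i * g (n ∸ i)) (λ i → f i * h (n ∸ i)) (suc n))

⊛-y·-comm : ∀ f g → f ⊛ (y· g) ≗ y· (f ⊛ g)
⊛-y·-comm f g zero    = trans (+-identityʳ (f 0 * 0)) (*-zeroʳ (f 0))
⊛-y·-comm f g (suc n) = begin
  (f ⊛ (y· g)) (suc n)
    ≡⟨ sumTo-snoc (λ i → f i * (y· g) (suc n ∸ i)) (suc n) ⟩
  sumTo (λ i → f i * (y· g) (suc n ∸ i)) (suc n) + f (suc n) * (y· g) (suc n ∸ suc n)
    ≡⟨ cong₂ _+_ (sumTo-cong (suc n) shifted) (cong (λ j → f (suc n) * (y· g) j) (n∸n≡0 n)) ⟩
  sumTo (λ i → f i * g (n ∸ i)) (suc n) + f (suc n) * 0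
    ≡⟨ cong ((f ⊛ g) n +_) (*-zeroʳ (f (suc n))) ⟩
  sumTo (λ i → f i * g (n ∸ i)) (suc n) + 0
    ≡⟨ +-identityʳ _ ⟩
  (f ⊛ g) n ∎
  where
  shifted : ∀ i → i < suc n → f i * (y· g) (suc n ∸ i) ≡ f i * g (n ∸ i)
  shifted i (s≤s i≤n) = cong (λ j → f i * (y· g) j) (+-∸-assoc 1 i≤n)

yPow-≢ : ∀ {K i} → i ≢ K → yPow K i ≡ 0
yPow-≢ {K} {i} i≢K with i ≟ K
... | yes i≡K = contradiction i≡K i≢K
... | no  _   = refl

yPow-≡ : ∀ K → yPow K K ≡ 1
yPow-≡ K with K ≟ K
... | yes _   = refl
... | no  K≢K = contradiction refl K≢K

yPow-⊛-+ : ∀ K m f → (yPow K ⊛ f) (K + m) ≡ f m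
yPow-⊛-+ K m f = begin
  sumTo term (suc (K + m))
    ≡⟨ cong (sumTo term) (+-suc K m) ⟨
  sumTo term (K + suc m)
    ≡⟨ sumTo-split term K (suc m) ⟩
  sumTo term K + sumTo (λ t → term (K + t)) (suc m)
    ≡⟨ cong₂ _+_ (sumTo-zeros K below) (sumTo-suc _ m) ⟩
  term (K + 0) + sumTo (λ t → term (K + suc t)) m
    ≡⟨ cong₂ _+_ diagonal (sumTo-zeros m above) ⟩
  f m + 0
    ≡⟨ +-identityʳ (f m) ⟩
  f m ∎
  where
  term : ℕ → ℕ
  term i = yPow K i * f (K + m ∸ i)
  below : ∀ i → i < K → term i ≡ 0
  below i i<K = cong (_* f (K + m ∸ i)) (yPow-≢ (<⇒≢ i<K))
  above : ∀ t → t < m → term (K + suc t) ≡ 0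
  above t _ = cong (_* f (K + m ∸ (K + suc t))) (yPow-≢ (m+1+n≢m K))
  diagonal : term (K + 0) ≡ f m
  diagonal = begin
    yPow K (K + 0) * f (K + m ∸ (K + 0)) ≡⟨ cong (λ j → yPow K j * f (K + m ∸ j)) (+-identityʳ K) ⟩
    yPow K K * f (K + m ∸ K)             ≡⟨ cong₂ _*_ (yPow-≡ K) (cong f (m+n∸m≡n K m)) ⟩
    1 * f m                              ≡⟨ *-identityˡ (f m) ⟩
    f m                                  ∎

yPow-⊛-< : ∀ K n f → n < K → (yPow K ⊛ f) n ≡ 0
yPow-⊛-< K n f n<K =
  sumTo-zeros (suc n) (λ i i≤n → cong (_* f (n ∸ i)) (yPow-≢ (<⇒≢ (≤-<-trans (≤-pred i≤n) n<K))))

-- Binomial coefficients and the coefficients of C(y)^r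

C-swap : ∀ a b {n} → a + b ≡ n → n C a ≡ n C b
C-swap a b refl = trans (nCk≡nC[n∸k] (m≤m+n a b)) (cong ((a + b) C_) (m+n∸m≡n a b))

C-absorption : ∀ n k → suc k * (suc n C suc k) ≡ suc n * (n C k)
C-absorption zero    zero    = refl
C-absorption zero    (suc k) = *-zeroʳ (suc (suc k))
C-absorption (suc n) zero    = begin
  1 * (suc (suc n) C 1) ≡⟨ *-identityˡ _ ⟩
  suc (suc n) C 1       ≡⟨ nC1≡n (suc (suc n)) ⟩
  suc (suc n)           ≡⟨ *-identityʳ _ ⟨
  suc (suc n) * 1       ∎
C-absorption (suc n) (suc k) = begin
  suc (suc k) * (suc (suc n) C suc (suc k))
    ≡⟨ cong (suc (suc k) *_) (pascal (suc n) (suc k)) ⟨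
  suc (suc k) * (x + y)
    ≡⟨ expand k x y ⟩
  (suc k * x + x) + suc (suc k) * y
    ≡⟨ cong₂ (λ u v → (u + x) + v) (C-absorption n k) (C-absorption n (suc k)) ⟩
  (suc n * (n C k) + x) + suc n * (n C suc k)
    ≡⟨ collect n (n C k) x (n C suc k) ⟩
  suc n * (n C k + n C suc k) + x
    ≡⟨ cong (λ z → suc n * z + x) (pascal n k) ⟩
  suc n * x + x
    ≡⟨ +-comm (suc n * x) x ⟩
  suc (suc n) * x ∎
  where
  x = suc n C suc k
  y = suc n C suc (suc k)
  expand : ∀ k x y → suc (suc k) * (x + y) ≡ (suc k * x + x) + suc (suc k) * y
  expand = solve-∀
  collect : ∀ n a x b → (suc n * a + x) + suc n * b ≡ suc n * (a + b) + x
  collect = solve-∀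

-- ballot m r is the coefficient of y^m in C(y)^r: the clauses are C^0 = 1 and
-- C^(r+1) = C^r + y C^(r+2), which is C = 1 + y C² multiplied by C^r.
ballot : ℕ → ℕ → ℕ
ballot zero    r       = 1
ballot (suc m) zero    = 0
ballot (suc m) (suc r) = ballot (suc m) r + ballot m (2 + r)

ballotSeries : ℕ → Series
ballotSeries r m = ballot m r

m+[1+m]+r≡m+m+[1+r] : ∀ m r → m + suc m + r ≡ m + m + suc r
m+[1+m]+r≡m+m+[1+r] = solve-∀

pascal-step : ∀ {M b₁ b₂} y → b₂ + M C suc y ≡ M C y → b₁ + M C suc (suc y) ≡ M C suc y →
              (b₂ + b₁) + suc M C suc (suc y) ≡ suc M C suc y
pascal-step {M} {b₁} {b₂} y eq₂ eq₁ = begin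
  (b₂ + b₁) + suc M C suc (suc y)           ≡⟨ cong ((b₂ + b₁) +_) (pascal M (suc y)) ⟨
  (b₂ + b₁) + (M C suc y + M C suc (suc y)) ≡⟨ +-interchange b₂ b₁ _ _ ⟩
  (b₂ + M C suc y) + (b₁ + M C suc (suc y)) ≡⟨ cong₂ _+_ eq₂ eq₁ ⟩
  M C y + M C suc y                         ≡⟨ pascal M y ⟩
  suc M C suc y                             ∎

-- By symmetry this says ballot m (r+1) = C(2m+r, m) - C(2m+r, m-1); written with
-- large lower indices it needs no subtraction and also holds for m = 0.
ballot-binomial : ∀ m r {N i} → N ≡ m + m + r → i ≡ m + r → ballot m (suc r) + N C suc i ≡ N C i
ballot-binomial zero    r       refl refl = trans (cong suc (k>n⇒nCk≡0 (n<1+n r))) (sym (nCn≡1 r))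
ballot-binomial (suc m) zero    refl refl =
  pascal-step (m + 0) (C-swap (suc (m + 0)) (m + 0) (arith m))
                      (ballot-binomial m 1 (m+[1+m]+r≡m+m+[1+r] m 0) (sym (+-suc m 0)))
  where
  arith : ∀ m → suc (m + 0) + (m + 0) ≡ m + suc m + 0
  arith = solve-∀
ballot-binomial (suc m) (suc r) refl refl =
  pascal-step (m + suc r) (ballot-binomial (suc m) r (+-suc (m + suc m) r) (+-suc m r))
                          (ballot-binomial m (2 + r) (m+[1+m]+r≡m+m+[1+r] m (suc r)) (sym (+-suc m (suc r))))

catalan-ratio : ∀ m → suc (suc m) * ((2 + (m + m)) C suc (suc m)) ≡ suc m * ((2 + (m + m)) C suc m)
catalan-ratio m = begin
  suc (suc m) * (B C suc (suc m))       ≡⟨ C-absorption (suc (m + m)) (suc m) ⟩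
  B * (suc (m + m) C suc m)             ≡⟨ cong (B *_) (C-swap m (suc m) (+-suc m m)) ⟨
  B * (suc (m + m) C m)                 ≡⟨ C-absorption (suc (m + m)) m ⟨
  suc m * (B C suc m)                   ∎
  where
  B = 2 + (m + m)

catalan-binomial : ∀ m → (2 + (m + m)) C suc m ≡ ballot (suc m) 1 * suc (suc m)
catalan-binomial m = +-cancelʳ-≡ (suc m * X) _ _ (begin
  suc (suc m) * X
    ≡⟨ cong (suc (suc m) *_) ballot-C ⟨
  suc (suc m) * (ballot (suc m) 1 + Y)
    ≡⟨ *-distribˡ-+ (suc (suc m)) (ballot (suc m) 1) Y ⟩
  suc (suc m) * ballot (suc m) 1 + suc (suc m) * Y
    ≡⟨ cong₂ _+_ (*-comm (suc (suc m)) (ballot (suc m) 1)) (catalan-ratio m) ⟩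
  ballot (suc m) 1 * suc (suc m) + suc m * X ∎)
  where
  X = (2 + (m + m)) C suc m
  Y = (2 + (m + m)) C suc (suc m)
  ballot-C : ballot (suc m) 1 + Y ≡ X
  ballot-C = ballot-binomial (suc m) 0 (2+m+m m) (sym (+-identityʳ (suc m)))
    where
    2+m+m : ∀ m → 2 + (m + m) ≡ suc m + suc m + 0
    2+m+m = solve-∀

Cser≗ballot1 : Cser ≗ ballotSeries 1
Cser≗ballot1 zero    = refl
Cser≗ballot1 (suc m) = begin
  ((suc m + suc m) C suc m) / suc (suc m)
    ≡⟨ cong (λ n → (n C suc m) / suc (suc m)) (cong suc (+-suc m m)) ⟩
  ((2 + (m + m)) C suc m) / suc (suc m)
    ≡⟨ cong (_/ suc (suc m)) (catalan-binomial m) ⟩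
  (ballot (suc m) 1 * suc (suc m)) / suc (suc m)
    ≡⟨ m*n/n≡m (ballot (suc m) 1) (suc (suc m)) ⟩
  ballot (suc m) 1 ∎

ballotSeries-zero : ballotSeries 0 ≗ 𝟙
ballotSeries-zero zero    = refl
ballotSeries-zero (suc m) = refl

ballotSeries-suc : ∀ r → ballotSeries (suc r) ≗ ballotSeries r ⊕ y· ballotSeries (2 + r)
ballotSeries-suc r zero    = refl
ballotSeries-suc r (suc m) = refl

⊛-⊕-y· : ∀ f g h → f ⊛ (g ⊕ y· h) ≗ (f ⊛ g) ⊕ y· (f ⊛ h)
⊛-⊕-y· f g h n = trans (⊛-distribˡ-⊕ f g (y· h) n) (cong ((f ⊛ g) n +_) (⊛-y·-comm f h n))

⊛-ballotSeries-suc : ∀ f r → f ⊛ ballotSeries (suc r) ≗ (f ⊛ ballotSeries r) ⊕ y· (f ⊛ ballotSeries (2 + r))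
⊛-ballotSeries-suc f r n =
  trans (⊛-congˡ f (ballotSeries-suc r) n) (⊛-⊕-y· f (ballotSeries r) (ballotSeries (2 + r)) n)

Cser-⊛-ballotSeries : ∀ m r → (Cser ⊛ ballotSeries r) m ≡ ballot m (suc r)
Cser-⊛-ballotSeries m       zero    =
  trans (⊛-congˡ Cser ballotSeries-zero m) (trans (⊛-identityʳ Cser m) (Cser≗ballot1 m))
Cser-⊛-ballotSeries zero    (suc r) =
  trans (⊛-ballotSeries-suc Cser r 0) (cong (_+ 0) (Cser-⊛-ballotSeries 0 r))
Cser-⊛-ballotSeries (suc m) (suc r) =
  trans (⊛-ballotSeries-suc Cser r (suc m))
        (cong₂ _+_ (Cser-⊛-ballotSeries (suc m) r) (Cser-⊛-ballotSeries m (2 + r)))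

Cser^≗ballotSeries : ∀ r → Cser ^ˢ r ≗ ballotSeries r
Cser^≗ballotSeries zero    n = sym (ballotSeries-zero n)
Cser^≗ballotSeries (suc r) n = trans (⊛-congˡ Cser (Cser^≗ballotSeries r) n) (Cser-⊛-ballotSeries n r)

-- Counting ordered preference lists by their first preference

count : {A : Set} → (A → Bool) → List A → ℕ
count p xs = length (filterᵇ p xs)

count-cong : ∀ {A : Set} {p q : A → Bool} xs → (∀ x → p x ≡ q x) → count p xs ≡ count q xs
count-cong         []       p≡q = refl
count-cong {q = q} (x ∷ xs) p≡q rewrite p≡q x with q x
... | true  = cong suc (count-cong xs p≡q)
... | false = count-cong xs p≡q

count-false : ∀ {A : Set} (xs : List A) → count (λ _ → false) xs ≡ 0
count-false []       = refl
count-false (x ∷ xs) = count-false xs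

count-++ : ∀ {A : Set} (p : A → Bool) xs ys → count p (xs ++ ys) ≡ count p xs + count p ys
count-++ p []       ys = refl
count-++ p (x ∷ xs) ys with p x
... | true  = cong suc (count-++ p xs ys)
... | false = count-++ p xs ys

count-concatMap : ∀ {A B : Set} (p : B → Bool) (g : A → List B) xs →
                  count p (concatMap g xs) ≡ sum (map (count p ∘ g) xs)
count-concatMap p g []       = refl
count-concatMap p g (x ∷ xs) =
  trans (count-++ p (g x) (concatMap g xs)) (cong (count p (g x) +_) (count-concatMap p g xs))

count-map : ∀ {A B : Set} (p : B → Bool) (f : A → B) xs → count p (map f xs) ≡ count (p ∘ f) xs
count-map p f []       = refl
count-map p f (x ∷ xs) with p (f x)
... | true  = cong suc (count-map p f xs)
... | false = count-map p f xs

orderedFrom : ℕ → List ℕ → Bool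
orderedFrom lo []      = true
orderedFrom lo (a ∷ s) = ⌊ lo ≤? a ⌋ ∧ orderedFrom a s

isOrdered-∷ : ∀ a s → isOrdered (a ∷ s) ≡ orderedFrom a s
isOrdered-∷ a []      = refl
isOrdered-∷ a (b ∷ s) with ⌊ a ≤? b ⌋
... | true  = isOrdered-∷ b s
... | false = refl

isOrdered≡orderedFrom0 : ∀ s → isOrdered s ≡ orderedFrom 0 s
isOrdered≡orderedFrom0 []      = refl
isOrdered≡orderedFrom0 (a ∷ s) = isOrdered-∷ a s

addFlaw : (parked : Bool) → ℕ → ℕ
addFlaw true  j = j
addFlaw false j = suc j

-- If g j counts the ways for the later cars to produce j flaws, then
-- countAddFlaw parked g k counts the ways to reach k flaws in total.
countAddFlaw : (parked : Bool) → (ℕ → ℕ) → ℕ → ℕ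
countAddFlaw true  g k       = g k
countAddFlaw false g zero    = 0
countAddFlaw false g (suc k) = g k

countAddFlaw-cong : ∀ b {g h} k → g ≗ h → countAddFlaw b g k ≡ countAddFlaw b h k
countAddFlaw-cong true  k       g≗h = g≗h k
countAddFlaw-cong false zero    g≗h = refl
countAddFlaw-cong false (suc k) g≗h = g≗h k

⌊⌋-true : ∀ {P : Set} (d : Dec P) → P → ⌊ d ⌋ ≡ true
⌊⌋-true d p = trans (isYes≗does d) (dec-true d p)

⌊⌋-false : ∀ {P : Set} (d : Dec P) → ¬ P → ⌊ d ⌋ ≡ false
⌊⌋-false d ¬p = trans (isYes≗does d) (dec-false d ¬p)

≟-suc : ∀ j k → ⌊ suc j ≟ suc k ⌋ ≡ ⌊ j ≟ k ⌋
≟-suc j k = trans (isYes≗does (suc j ≟ suc k)) (sym (isYes≗does (j ≟ k)))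

count-addFlaw : ∀ {A : Set} (q : A → Bool) (f : A → ℕ) b k xs →
                count (λ x → q x ∧ ⌊ addFlaw b (f x) ≟ k ⌋) xs
                  ≡ countAddFlaw b (λ j → count (λ x → q x ∧ ⌊ f x ≟ j ⌋) xs) k
count-addFlaw q f true  k       xs = refl
count-addFlaw q f false zero    xs = trans (count-cong xs (λ x → ∧-zeroʳ (q x))) (count-false xs)
count-addFlaw q f false (suc k) xs = count-cong xs (λ x → cong (q x ∧_) (≟-suc (f x) k))

runFlaws-∷ : ∀ a s lot → runFlaws (a ∷ s) lot
           ≡ addFlaw (proj₂ (parkAt (a ∸ 1) lot)) (runFlaws s (proj₁ (parkAt (a ∸ 1) lot)))
runFlaws-∷ a s lot with parkAt (a ∸ 1) lot
... | _ , true  = refl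
... | _ , false = refl

orderedRuns : (n len : ℕ) → List Bool → (lo k : ℕ) → ℕ
orderedRuns n len lot lo k = count (λ s → orderedFrom lo s ∧ ⌊ runFlaws s lot ≟ k ⌋) (seqs n len)

firstCarAt : (n len : ℕ) → List Bool → (a k : ℕ) → ℕ
firstCarAt n len lot a k =
  countAddFlaw (proj₂ (parkAt (a ∸ 1) lot)) (orderedRuns n len (proj₁ (parkAt (a ∸ 1) lot)) a) k

orderedRuns-zero : ∀ n lot lo k → orderedRuns n 0 lot lo k ≡ 𝟙 k
orderedRuns-zero n lot lo zero    = refl
orderedRuns-zero n lot lo (suc k) = refl

count-∷-orderedRuns : ∀ n len lot lo k a →
  count (λ s → orderedFrom lo (a ∷ s) ∧ ⌊ runFlaws (a ∷ s) lot ≟ k ⌋) (seqs n len)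
    ≡ (if ⌊ lo ≤? a ⌋ then firstCarAt n len lot a k else 0)
count-∷-orderedRuns n len lot lo k a with ⌊ lo ≤? a ⌋
... | false = count-false (seqs n len)
... | true  = trans
  (count-cong (seqs n len) (λ s → cong (λ j → orderedFrom a s ∧ ⌊ j ≟ k ⌋) (runFlaws-∷ a s lot)))
  (count-addFlaw (orderedFrom a) (λ s → runFlaws s (proj₁ (parkAt (a ∸ 1) lot)))
                 (proj₂ (parkAt (a ∸ 1) lot)) k (seqs n len))

orderedRuns-suc : ∀ n len lot lo k → orderedRuns n (suc len) lot lo k
                ≡ sumTo (λ i → if ⌊ lo ≤? suc i ⌋ then firstCarAt n len lot (suc i) k else 0) n
orderedRuns-suc n len lot lo k = begin
  count p (concatMap g (map suc (upTo n)))
    ≡⟨ count-concatMap p g (map suc (upTo n)) ⟩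
  sum (map (count p ∘ g) (map suc (upTo n)))
    ≡⟨ cong sum (map-∘ (upTo n)) ⟨
  sumTo (count p ∘ g ∘ suc) n
    ≡⟨ sumTo-cong n (λ i _ → trans (count-map p (suc i ∷_) (seqs n len))
                                                                            (count-∷-orderedRuns n len lot lo k (suc i))) ⟩
  sumTo (λ i → if ⌊ lo ≤? suc i ⌋ then firstCarAt n len lot (suc i) k else 0) n ∎
  where
  p = λ s → orderedFrom lo s ∧ ⌊ runFlaws s lot ≟ k ⌋
  g = λ a → map (a ∷_) (seqs n len)

orderedRuns-0≡1 : ∀ n len lot k → orderedRuns n len lot 0 k ≡ orderedRuns n len lot 1 k
orderedRuns-0≡1 n zero      lot k = trans (orderedRuns-zero n lot 0 k) (sym (orderedRuns-zero n lot 1 k))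
orderedRuns-0≡1 n (suc len) lot k = trans (orderedRuns-suc n len lot 0 k) (sym (orderedRuns-suc n len lot 1 k))

orderedRuns-above : ∀ n len lot p m k → p + m ≡ n →
  orderedRuns n (suc len) lot (suc p) k ≡ sumTo (λ t → firstCarAt n len lot (suc (p + t)) k) m
orderedRuns-above n len lot p m k refl = begin
  orderedRuns (p + m) (suc len) lot (suc p) k
    ≡⟨ orderedRuns-suc (p + m) len lot (suc p) k ⟩
  sumTo term (p + m)
    ≡⟨ sumTo-split term p m ⟩
  sumTo term p + sumTo (λ t → term (p + t)) m
    ≡⟨ cong₂ _+_ (sumTo-zeros p below) (sumTo-cong m (λ t _ → above t)) ⟩
  sumTo (λ t → firstCarAt (p + m) len lot (suc (p + t)) k) m ∎
  where
  term = λ i → if ⌊ suc p ≤? suc i ⌋ then firstCarAt (p + m) len lot (suc i) k else 0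
  below : ∀ i → i < p → term i ≡ 0
  below i i<p = cong (λ b → if b then firstCarAt (p + m) len lot (suc i) k else 0)
                     (⌊⌋-false (suc p ≤? suc i) (<⇒≱ i<p ∘ ≤-pred))
  above : ∀ t → term (p + t) ≡ firstCarAt (p + m) len lot (suc (p + t)) k
  above t = cong (λ b → if b then firstCarAt (p + m) len lot (suc (p + t)) k else 0)
                 (⌊⌋-true (suc p ≤? suc (p + t)) (s≤s (m≤m+n p t)))

parkAt-++ : ∀ pre lot i → parkAt (length pre + i) (pre ++ lot) ≡ (pre ++ proj₁ (parkAt i lot) , proj₂ (parkAt i lot))
parkAt-++ []        lot i = refl
parkAt-++ (b ∷ pre) lot i rewrite parkAt-++ pre lot i = refl

length-parkAt : ∀ i lot → length (proj₁ (parkAt i lot)) ≡ length lot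
length-parkAt i       []            = refl
length-parkAt zero    (false ∷ lot) = refl
length-parkAt zero    (true  ∷ lot) = cong suc (length-parkAt zero lot)
length-parkAt (suc i) (b ∷ lot)     = cong suc (length-parkAt i lot)

-- runsOn len seg k counts the ordered preference lists of length len with k flaws
-- on the lot segment seg, all preferences pointing into seg.  Either the first car
-- prefers the first space of seg, or that space is never looked at again.
runsOn : ℕ → List Bool → ℕ → ℕ
runsOn zero      seg       k = 𝟙 k
runsOn (suc len) []        k = 0
runsOn (suc len) (b ∷ seg) k =
  countAddFlaw (proj₂ (parkAt 0 (b ∷ seg))) (runsOn len (proj₁ (parkAt 0 (b ∷ seg)))) k + runsOn (suc len) seg k

-- The spaces of pre lie left of every remaining preference, so only seg matters.
mutual
  orderedRuns≡runsOn : ∀ n len lot pre seg k → lot ≡ pre ++ seg → length pre + length seg ≡ n →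
                       orderedRuns n len lot (suc (length pre)) k ≡ runsOn len seg k
  orderedRuns≡runsOn n zero      lot pre seg k _     _  = orderedRuns-zero n lot _ k
  orderedRuns≡runsOn n (suc len) lot pre seg k lot≡ n≡ =
    trans (orderedRuns-above n len lot (length pre) (length seg) k n≡) (firstCars≡runsOn n len lot pre seg k lot≡ n≡)

  firstCars≡runsOn : ∀ n len lot pre seg k → lot ≡ pre ++ seg → length pre + length seg ≡ n →
    sumTo (λ t → firstCarAt n len lot (suc (length pre + t)) k) (length seg) ≡ runsOn (suc len) seg k
  firstCars≡runsOn n len lot pre []        k _    _  = refl
  firstCars≡runsOn n len lot pre (b ∷ seg) k lot≡ n≡ =
    trans (sumTo-suc car (length seg)) (cong₂ _+_ first rest)
    where
    p = length pre
    car = λ t → firstCarAt n len lot (suc (p + t)) k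
    parked = parkAt 0 (b ∷ seg)
    park : parkAt (p + 0) lot ≡ (pre ++ proj₁ parked , proj₂ parked)
    park = trans (cong (parkAt (p + 0)) lot≡) (parkAt-++ pre (b ∷ seg) 0)
    first : car 0 ≡ countAddFlaw (proj₂ parked) (runsOn len (proj₁ parked)) k
    first = begin
      countAddFlaw (proj₂ (parkAt (p + 0) lot)) (orderedRuns n len (proj₁ (parkAt (p + 0) lot)) (suc (p + 0))) k
        ≡⟨ cong (λ r → countAddFlaw (proj₂ r) (orderedRuns n len (proj₁ r) (suc (p + 0))) k) park ⟩
      countAddFlaw (proj₂ parked) (orderedRuns n len (pre ++ proj₁ parked) (suc (p + 0))) k
        ≡⟨ cong (λ i → countAddFlaw (proj₂ parked) (orderedRuns n len (pre ++ proj₁ parked) (suc i)) k) (+-identityʳ p) ⟩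
      countAddFlaw (proj₂ parked) (orderedRuns n len (pre ++ proj₁ parked) (suc p)) k
        ≡⟨ countAddFlaw-cong (proj₂ parked) k (λ j → orderedRuns≡runsOn n len _ pre (proj₁ parked) j refl
             (trans (cong (p +_) (length-parkAt 0 (b ∷ seg))) n≡)) ⟩
      countAddFlaw (proj₂ parked) (runsOn len (proj₁ parked)) k ∎
    p′≡1+p : length (pre ++ [ b ]) ≡ p + 1
    p′≡1+p = length-++ pre
    rest : sumTo (car ∘ suc) (length seg) ≡ runsOn (suc len) seg k
    rest = begin
      sumTo (car ∘ suc) (length seg)
        ≡⟨ sumTo-cong (length seg) (λ t _ → cong (λ i → firstCarAt n len lot (suc i) k)
                                                  (sym (trans (cong (_+ t) p′≡1+p) (+-assoc p 1 t)))) ⟩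
      sumTo (λ t → firstCarAt n len lot (suc (length (pre ++ [ b ]) + t)) k) (length seg)
        ≡⟨ firstCars≡runsOn n len lot (pre ++ [ b ]) seg k (trans lot≡ (sym (++-assoc pre [ b ] seg)))
                            (trans (cong (_+ length seg) p′≡1+p) (trans (+-assoc p 1 (length seg)) n≡)) ⟩
      runsOn (suc len) seg k ∎

-- Segments of occupied and free spaces

-- Starting from an empty lot, the spaces from the last preference onwards always look like this.
segment : ℕ → ℕ → List Bool
segment c e = replicate c true ++ replicate e false

parkAt-segment-full : ∀ c → parkAt 0 (segment c 0) ≡ (segment c 0 , false)
parkAt-segment-full zero    = refl
parkAt-segment-full (suc c) = cong (λ r → true ∷ proj₁ r , proj₂ r) (parkAt-segment-full c)

parkAt-segment-free : ∀ c e → parkAt 0 (segment c (suc e)) ≡ (segment (suc c) e , true)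
parkAt-segment-free zero    e = refl
parkAt-segment-free (suc c) e = cong (λ r → true ∷ proj₁ r , proj₂ r) (parkAt-segment-free c e)

-- flawsAtLeast l c e k counts the preference lists of runsOn l (segment c e) with at least k flaws.
flawsAtLeast : ℕ → ℕ → ℕ → ℕ → ℕ
flawsAtLeast zero    c       e       zero    = 1
flawsAtLeast zero    c       e       (suc k) = 0
flawsAtLeast (suc l) zero    zero    k       = 0
flawsAtLeast (suc l) zero    (suc e) k       = flawsAtLeast l 1 e k + flawsAtLeast (suc l) zero e k
flawsAtLeast (suc l) (suc c) zero    k       = flawsAtLeast l (suc c) zero (pred k) + flawsAtLeast (suc l) c zero k
flawsAtLeast (suc l) (suc c) (suc e) k       = flawsAtLeast l (suc (suc c)) e k + flawsAtLeast (suc l) c (suc e) k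

runsOn-occupied-full : ∀ l c k → runsOn (suc l) (segment (suc c) 0) k
                     ≡ countAddFlaw false (runsOn l (segment (suc c) 0)) k + runsOn (suc l) (segment c 0) k
runsOn-occupied-full l c k rewrite parkAt-segment-full c = refl

runsOn-occupied-free : ∀ l c e k → runsOn (suc l) (segment (suc c) (suc e)) k
                     ≡ runsOn l (segment (suc (suc c)) e) k + runsOn (suc l) (segment c (suc e)) k
runsOn-occupied-free l c e k rewrite parkAt-segment-free c e = refl

runsOn-segment : ∀ l c e k → runsOn l (segment c e) k + flawsAtLeast l c e (suc k) ≡ flawsAtLeast l c e k
runsOn-segment zero    c       e       zero    = refl
runsOn-segment zero    c       e       (suc k) = refl
runsOn-segment (suc l) zero    zero    k       = refl
runsOn-segment (suc l) zero    (suc e) k       =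
  trans (+-interchange (runsOn l (segment 1 e) k) _ _ _)
        (cong₂ _+_ (runsOn-segment l 1 e k) (runsOn-segment (suc l) zero e k))
runsOn-segment (suc l) (suc c) zero    k       =
  trans (cong (_+ flawsAtLeast (suc l) (suc c) zero (suc k)) (runsOn-occupied-full l c k))
  (trans (+-interchange (countAddFlaw false (runsOn l (segment (suc c) 0)) k) _ _ _)
         (cong₂ _+_ (failed k) (runsOn-segment (suc l) c zero k)))
  where
  failed : ∀ k → countAddFlaw false (runsOn l (segment (suc c) 0)) k + flawsAtLeast l (suc c) zero k
               ≡ flawsAtLeast l (suc c) zero (pred k)
  failed zero    = refl
  failed (suc k) = runsOn-segment l (suc c) zero k
runsOn-segment (suc l) (suc c) (suc e) k       =
  trans (cong (_+ flawsAtLeast (suc l) (suc c) (suc e) (suc k)) (runsOn-occupied-free l c e k))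
  (trans (+-interchange (runsOn l (segment (suc (suc c)) e) k) _ _ _)
         (cong₂ _+_ (runsOn-segment l (suc (suc c)) e k) (runsOn-segment (suc l) c (suc e) k)))

pascal-sum : ∀ {a b M N} x → a ≡ M C x → b ≡ M C suc x → suc M ≡ N → a + b ≡ N C suc x
pascal-sum x refl refl refl = pascal _ x

m+[1+n]∸1≡m+n : ∀ m n → m + suc n ∸ 1 ≡ m + n
m+[1+n]∸1≡m+n m n = cong (_∸ 1) (+-suc m n)

m+[2+n+o]∸1≡m+[n+[1+o]] : ∀ m n o → m + (2 + n + o) ∸ 1 ≡ m + (n + suc o)
m+[2+n+o]∸1≡m+[n+[1+o]] m n o = trans (m+[1+n]∸1≡m+n m (suc (n + o))) (cong (m +_) (sym (+-suc n o)))

-- When e + k ≤ l every run has at least k flaws, since at most e cars park.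
flawsAtLeast-saturated : ∀ l c e k → e + k ≤ l → flawsAtLeast l c e k ≡ (l + (c + e) ∸ 1) C l
flawsAtLeast-saturated zero    c       e       k h rewrite n≤0⇒n≡0 (m+n≤o⇒n≤o e h) = refl
flawsAtLeast-saturated (suc l) zero    zero    k h = sym (k>n⇒nCk≡0 (s≤s (≤-reflexive (+-identityʳ l))))
flawsAtLeast-saturated (suc l) zero    (suc e) k h =
  pascal-sum l (trans (flawsAtLeast-saturated l 1 e k (≤-pred h)) (cong (_C l) (m+[1+n]∸1≡m+n l e)))
            (flawsAtLeast-saturated (suc l) zero e k (m≤n⇒m≤1+n (≤-pred h)))
            (sym (+-suc l e))
flawsAtLeast-saturated (suc l) (suc c) zero    k h =
  pascal-sum l (trans (flawsAtLeast-saturated l (suc c) zero (pred k) (pred-mono-≤ h))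
                      (cong (_C l) (m+[1+n]∸1≡m+n l (c + 0))))
            (flawsAtLeast-saturated (suc l) c zero k h)
            (sym (+-suc l (c + 0)))
flawsAtLeast-saturated (suc l) (suc c) (suc e) k h =
  pascal-sum l (trans (flawsAtLeast-saturated l (suc (suc c)) e k (≤-pred h))
                   (cong (_C l) (m+[2+n+o]∸1≡m+[n+[1+o]] l c e)))
            (flawsAtLeast-saturated (suc l) c (suc e) k h)
            (sym (+-suc l (c + suc e)))

flawsAtLeast-full : ∀ l c k → l < k → flawsAtLeast l c 0 k ≡ 0
flawsAtLeast-full zero    c       (suc k) _       = refl
flawsAtLeast-full (suc l) zero    k       _       = refl
flawsAtLeast-full (suc l) (suc c) (suc k) (s≤s h) =
  cong₂ _+_ (flawsAtLeast-full l (suc c) k h) (flawsAtLeast-full (suc l) c (suc k) (s≤s h))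

-- By symmetry the binomial is C(l+c+e-1, l-k-2); this form also vanishes when l ≤ k+1.
flawsAtLeast-unsaturated : ∀ l c e k → l < e + suc k →
                           flawsAtLeast l c e (suc k) ≡ (l + (c + e) ∸ 1) C (c + e + suc k)
flawsAtLeast-unsaturated zero    c       e       k h =
  sym (k>n⇒nCk≡0 (≤-<-trans (m∸n≤m (c + e) 1) (m<m+n (c + e) z<s)))
flawsAtLeast-unsaturated (suc l) zero    zero    k h =
  sym (k>n⇒nCk≡0 (≤-trans (s≤s (≤-reflexive (+-identityʳ l))) (<⇒≤ h)))
flawsAtLeast-unsaturated (suc l) zero    (suc e) k h =
  trans (+-comm (flawsAtLeast l 1 e (suc k)) _)
        (pascal-sum (e + suc k) later
                 (trans (flawsAtLeast-unsaturated l 1 e k (≤-pred h))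
                        (cong (_C suc (e + suc k)) (m+[1+n]∸1≡m+n l e)))
                 (sym (+-suc l e)))
  where
  later : flawsAtLeast (suc l) zero e (suc k) ≡ (l + e) C (e + suc k)
  later with suc l <? e + suc k
  ... | yes h′ = flawsAtLeast-unsaturated (suc l) zero e k h′
  ... | no  h′ = trans (flawsAtLeast-saturated (suc l) zero e (suc k) (≮⇒≥ h′))
                       (cong ((l + e) C_) (≤-antisym (≤-pred h) (≮⇒≥ h′)))
flawsAtLeast-unsaturated (suc l) (suc c) zero    k h =
  trans (flawsAtLeast-full (suc l) (suc c) (suc k) h)
        (sym (k>n⇒nCk≡0 (subst (_< s + suc k) (+-comm s l) (+-monoʳ-< s (<-trans (n<1+n l) h)))))
  where
  s = suc (c + 0)
flawsAtLeast-unsaturated (suc l) (suc c) (suc e) k h =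
  trans (+-comm (flawsAtLeast l (suc (suc c)) e (suc k)) _)
        (pascal-sum (c + suc e + suc k) (flawsAtLeast-unsaturated (suc l) c (suc e) k h)
                 (trans (flawsAtLeast-unsaturated l (suc (suc c)) e k (≤-pred h))
                        (cong₂ _C_ (m+[2+n+o]∸1≡m+[n+[1+o]] l c e)
                                   (cong (λ x → suc (x + suc k)) (sym (+-suc c e)))))
                 (sym (+-suc l (c + suc e))))

flawsAtLeast-emptyLot : ∀ n k → flawsAtLeast n 0 n k ≡ (n + n ∸ 1) C (n + k)
flawsAtLeast-emptyLot n zero    = trans (flawsAtLeast-saturated n 0 n 0 (≤-reflexive (+-identityʳ n)))
                                        (cong ((n + n ∸ 1) C_) (sym (+-identityʳ n)))
flawsAtLeast-emptyLot n (suc k) = flawsAtLeast-unsaturated n 0 n k (m<m+n n z<s)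

op≡runsOn : ∀ n k → op n k ≡ runsOn n (segment 0 n) k
op≡runsOn n k = begin
  op n k
    ≡⟨ count-cong (prefSets n) (λ s → cong (_∧ ⌊ flaws n s ≟ k ⌋) (isOrdered≡orderedFrom0 s)) ⟩
  orderedRuns n n (replicate n false) 0 k
    ≡⟨ orderedRuns-0≡1 n n (replicate n false) k ⟩
  orderedRuns n n (replicate n false) 1 k
    ≡⟨ orderedRuns≡runsOn n n _ [] (replicate n false) k refl (length-replicate n) ⟩
  runsOn n (segment 0 n) k ∎

op-ballot : ∀ k m → op (suc k + m) k ≡ ballot m (suc k + suc k)
op-ballot k m = +-cancelʳ-≡ (X C suc (n + k)) _ _ (begin
  op n k + X C suc (n + k)              ≡⟨ cong (λ i → op n k + X C i) (+-suc n k) ⟨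
  op n k + X C (n + suc k)              ≡⟨ cong (op n k +_) (flawsAtLeast-emptyLot n (suc k)) ⟨
  op n k + flawsAtLeast n 0 n (suc k)   ≡⟨ cong (_+ flawsAtLeast n 0 n (suc k)) (op≡runsOn n k) ⟩
  runsOn n (segment 0 n) k + flawsAtLeast n 0 n (suc k)
                                        ≡⟨ runsOn-segment n 0 n k ⟩
  flawsAtLeast n 0 n k                  ≡⟨ flawsAtLeast-emptyLot n k ⟩
  X C (n + k)                           ≡⟨ ballot-binomial m (k + suc k) (top k m) (index k m) ⟨
  ballot m (suc k + suc k) + X C suc (n + k) ∎)
  where
  n = suc k + m
  X = n + n ∸ 1
  top : ∀ k m → (k + m) + suc (k + m) ≡ m + m + (k + suc k)
  top = solve-∀
  index : ∀ k m → suc k + m + k ≡ m + (k + suc k)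
  index = solve-∀

mainTheorem17 : (k n : ℕ) → phi k n ≡ (yPow (suc k) ⊛ (Cser ^ˢ (suc k + suc k))) n
mainTheorem17 k n with suc k ≤? n
... | no  k≮n = sym (yPow-⊛-< (suc k) n (Cser ^ˢ (suc k + suc k)) (≰⇒> k≮n))
... | yes k<n = begin
  op n k
    ≡⟨ cong (λ n → op n k) n≡k+m ⟨
  op (suc k + m) k
    ≡⟨ op-ballot k m ⟩
  ballot m (suc k + suc k)
    ≡⟨ Cser^≗ballotSeries (suc k + suc k) m ⟨
  (Cser ^ˢ (suc k + suc k)) m
    ≡⟨ yPow-⊛-+ (suc k) m (Cser ^ˢ (suc k + suc k)) ⟨
  (yPow (suc k) ⊛ (Cser ^ˢ (suc k + suc k))) (suc k + m)
    ≡⟨ cong (yPow (suc k) ⊛ (Cser ^ˢ (suc k + suc k))) n≡k+m ⟩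
  (yPow (suc k) ⊛ (Cser ^ˢ (suc k + suc k))) n ∎
  where
  m = n ∸ suc k
  n≡k+m : suc k + m ≡ n
  n≡k+m = m+[n∸m]≡n k<n
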